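{- Let $\mathfrak{G}$ be a group and let $F$ be a function from the class of all $\mathfrak{G}$-gain graphs to an abelian group such that $F(\Phi)=F(\Phi\setminus e)-F(\Phi/e)$ for every gain graph $\Phi$ and every neutral link $e$ of $\Phi$. Then $F$ satisfies neutral-loop nullity if and only if $F$ is invariant under neutral-edge simplification.
   Context: A $\mathfrak{G}$-gain graph $\Phi=(\Gamma,\varphi)$ is a finite graph $\Gamma=(V,E)$ (loops and multiple edges allowed) with a gain map $\varphi$ assigning to each oriented edge an element of $\mathfrak{G}$ such that reversing the orientation inverts the gain. An edge is neutral if its gain is the identity $1_{\mathfrak{G}}$. A link has two distinct endpoints. $\Phi\setminus e$ deletes $e$; for a neutral link $e$, $\Phi/e$ identifies the endpoints of $e$ and deletes $e$, keeping all other edges with their gains. Neutral-loop nullity: $F(\Phi)=0$ whenever $\Phi$ has a neutral loop. Invariance under neutral-edge simplification: $F(\Phi)=F(\Phi')$ whenever $\Phi'$ is obtained from $\Phi$ by removing one edge of a neutral digon (a pair of parallel links both having neutral gain). -}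

module Defs where

open import Level using (Level; _⊔_)
open import Algebra.Bundles using (Group; AbelianGroup)
open import Data.Nat using (ℕ; zero; suc)
open import Data.Fin using (Fin; punchOut; _≟_)
open import Data.List using (List; length; map; lookup; removeAt)
open import Data.Product using (Σ; _×_; _,_; proj₁; proj₂)
open import Data.Sum using (_⊎_)
open import Relation.Binary.PropositionalEquality using (_≡_; _≢_)
open import Relation.Nullary using (yes; no; ¬_)

-- An edge is stored with one chosen orientation as (tail , head , gain);
-- the opposite orientation of the same edge carries gain ⁻¹.
module _ {c ℓ : Level} (𝔊 : Group c ℓ) where
  open Group 𝔊 renaming (Carrier to G)

  Edge : ℕ → Set c
  Edge V = Fin V × Fin V × G

  record GainGraph : Set c where
    constructor gg
    field
      V     : ℕ
      edges : List (Edge V)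
  open GainGraph public

  EdgeIx : GainGraph → Set
  EdgeIx Φ = Fin (length (edges Φ))

  tail head : (Φ : GainGraph) → EdgeIx Φ → Fin (V Φ)
  tail Φ e = proj₁ (lookup (edges Φ) e)
  head Φ e = proj₁ (proj₂ (lookup (edges Φ) e))

  gain : (Φ : GainGraph) → EdgeIx Φ → G
  gain Φ e = proj₂ (proj₂ (lookup (edges Φ) e))

  IsLink : (Φ : GainGraph) → EdgeIx Φ → Set
  IsLink Φ e = tail Φ e ≢ head Φ e

  IsLoop : (Φ : GainGraph) → EdgeIx Φ → Set
  IsLoop Φ e = tail Φ e ≡ head Φ e

  IsNeutral : (Φ : GainGraph) → EdgeIx Φ → Set ℓ
  IsNeutral Φ e = gain Φ e ≈ ε

  HasNeutralLoop : GainGraph → Set ℓ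
  HasNeutralLoop Φ = Σ (EdgeIx Φ) λ e → IsLoop Φ e × IsNeutral Φ e

  delete : (Φ : GainGraph) → EdgeIx Φ → GainGraph
  delete Φ e = gg (V Φ) (removeAt (edges Φ) e)

  -- identify vertex v with vertex u (u ≢ v), removing v from the vertex set
  merge : ∀ {k} (u v : Fin (suc k)) → u ≢ v → Fin (suc k) → Fin k
  merge u v u≢v w with w ≟ v
  ... | yes _   = punchOut {i = v} {j = u} (λ v≡u → u≢v (Relation.Binary.PropositionalEquality.sym v≡u))
  ... | no w≢v  = punchOut {i = v} {j = w} (λ v≡w → w≢v (Relation.Binary.PropositionalEquality.sym v≡w))

  mapEdge : ∀ {V W} → (Fin V → Fin W) → Edge V → Edge W
  mapEdge f (x , y , g) = f x , f y , g

  contract : (Φ : GainGraph) (e : EdgeIx Φ) → IsLink Φ e → GainGraph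
  contract (gg zero es) e _ with lookup es e
  ... | (() , _)
  contract (gg (suc k) es) e lnk =
    gg k (map (mapEdge (merge (tail (gg (suc k) es) e) (head (gg (suc k) es) e) lnk))
              (removeAt es e))

  Parallel : (Φ : GainGraph) → EdgeIx Φ → EdgeIx Φ → Set
  Parallel Φ e f =
    (tail Φ e ≡ tail Φ f × head Φ e ≡ head Φ f) ⊎ (tail Φ e ≡ head Φ f × head Φ e ≡ tail Φ f)

  NeutralDigon : (Φ : GainGraph) → EdgeIx Φ → EdgeIx Φ → Set ℓ
  NeutralDigon Φ e f =
    e ≢ f × IsLink Φ e × IsLink Φ f × Parallel Φ e f × IsNeutral Φ e × IsNeutral Φ f

  module _ {a r : Level} (A : AbelianGroup a r) where
    open AbelianGroup A renaming (Carrier to M; _≈_ to _≈ᴬ_; ε to 0ᴬ; _-_ to _-ᴬ_)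

    DeletionContraction : (GainGraph → M) → Set (c ⊔ ℓ ⊔ r)
    DeletionContraction F =
      (Φ : GainGraph) (e : EdgeIx Φ) (lnk : IsLink Φ e) → IsNeutral Φ e →
      F Φ ≈ᴬ (F (delete Φ e) -ᴬ F (contract Φ e lnk))

    NeutralLoopNullity : (GainGraph → M) → Set (c ⊔ ℓ ⊔ r)
    NeutralLoopNullity F = (Φ : GainGraph) → HasNeutralLoop Φ → F Φ ≈ᴬ 0ᴬ

    InvariantUnderNeutralEdgeSimplification : (GainGraph → M) → Set (c ⊔ ℓ ⊔ r)
    InvariantUnderNeutralEdgeSimplification F =
      (Φ : GainGraph) (e f : EdgeIx Φ) → NeutralDigon Φ e f → F Φ ≈ᴬ F (delete Φ e)

-- If {e , f} is a neutral digon, contracting e turns f into a neutral loop, so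
-- F(Φ / e) = 0 under neutral-loop nullity and the deletion–contraction rule reads F(Φ) = F(Φ \ e).
-- Conversely, given a neutral loop at t in Φ, let Ψ be Φ with one new vertex w and the loop
-- replaced by two parallel neutral links t — w. Contracting one of them, e₀, gives back Φ, while
-- deleting it is a neutral-edge simplification, so F(Ψ \ e₀) = F(Ψ) = F(Ψ \ e₀) − F(Φ) and F(Φ) = 0.
module Submission where

open import Defs
open import Level using (Level)
open import Algebra.Bundles using (Group; AbelianGroup)
open import Function.Base using (_∘_)
open import Function.Bundles using (_⇔_; mk⇔)
open import Data.Nat using (suc)
open import Data.Fin using (Fin; zero; suc; _≟_)
open import Data.Fin.Properties using (¬Fin0; punchOut-cong)
open import Data.List using (List; _∷_; length; map; lookup; removeAt)
open import Data.List.Properties using (map-∘; map-id)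
open import Data.List.Membership.Propositional using (_∈_)
open import Data.List.Membership.Propositional.Properties using (∈-map⁺; ∈-lookup)
open import Data.List.Relation.Unary.Any using (here; there; index)
open import Data.List.Relation.Unary.Any.Properties using (lookup-index)
open import Data.Product using (Σ; _×_; _,_; proj₁; proj₂)
open import Data.Sum using (inj₁; inj₂)
open import Data.Empty using (⊥-elim)
open import Relation.Binary.PropositionalEquality as ≡ using (_≡_; _≢_; refl; cong; cong₂; subst)
open import Relation.Nullary using (yes; no)
import Algebra.Properties.Group as GroupProperties

lookup∈removeAt : ∀ {a} {A : Set a} (xs : List A) {i j : Fin (length xs)} →
  i ≢ j → lookup xs j ∈ removeAt xs i
lookup∈removeAt (x ∷ xs) {zero}  {zero}  i≢j = ⊥-elim (i≢j refl)
lookup∈removeAt (x ∷ xs) {zero}  {suc j} i≢j = ∈-lookup j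
lookup∈removeAt (x ∷ xs) {suc i} {zero}  i≢j = here refl
lookup∈removeAt (x ∷ xs) {suc i} {suc j} i≢j = there (lookup∈removeAt xs (i≢j ∘ cong suc))

module _ {c ℓ : Level} (G : Group c ℓ) where
  open Group G
  open GroupProperties G using (ε⁻¹≈ε; identityʳ-unique; ⁻¹-injective)

  z≈ε⇒y∙z⁻¹≈y : ∀ {y z} → z ≈ ε → y ∙ z ⁻¹ ≈ y
  z≈ε⇒y∙z⁻¹≈y z≈ε = trans (∙-congˡ (trans (⁻¹-cong z≈ε) ε⁻¹≈ε)) (identityʳ _)

  y∙z⁻¹≈y⇒z≈ε : ∀ {y z} → y ∙ z ⁻¹ ≈ y → z ≈ ε
  y∙z⁻¹≈y⇒z≈ε {y} {z} y∙z⁻¹≈y =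
    ⁻¹-injective (trans (identityʳ-unique y (z ⁻¹) y∙z⁻¹≈y) (sym ε⁻¹≈ε))

module _ {c ℓ : Level} (𝔊 : Group c ℓ) where
  open Group 𝔊 using (_≈_; ε)

  NeutralLoopEdge : ∀ {V} → Edge 𝔊 V → Set ℓ
  NeutralLoopEdge (a , b , g) = a ≡ b × g ≈ ε

  ∈⇒HasNeutralLoop : ∀ {Φ x} → x ∈ edges Φ → NeutralLoopEdge x → HasNeutralLoop 𝔊 Φ
  ∈⇒HasNeutralLoop x∈ loop = index x∈ , subst NeutralLoopEdge (lookup-index x∈) loop

  merge-identifies : ∀ {k} (u v : Fin (suc k)) (u≢v : u ≢ v) →
    merge 𝔊 u v u≢v u ≡ merge 𝔊 u v u≢v v
  merge-identifies u v u≢v with u ≟ v | v ≟ v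
  ... | yes u≡v | _ = ⊥-elim (u≢v u≡v)
  ... | no _ | yes _ = punchOut-cong v refl
  ... | no _ | no v≢v = ⊥-elim (v≢v refl)

  contract-neutralDigon : (Φ : GainGraph 𝔊) (e f : EdgeIx 𝔊 Φ) (digon : NeutralDigon 𝔊 Φ e f) →
    HasNeutralLoop 𝔊 (contract 𝔊 Φ e (proj₁ (proj₂ digon)))
  contract-neutralDigon Φ@(gg 0 es) e f _ = ⊥-elim (¬Fin0 (tail 𝔊 Φ e))
  contract-neutralDigon Φ@(gg (suc k) es) e f (e≢f , e-link , _ , e∥f , _ , f-neutral) =
    ∈⇒HasNeutralLoop (∈-map⁺ (mapEdge 𝔊 m) (lookup∈removeAt es e≢f)) (f-becomes-loop e∥f , f-neutral)
    where
    m : Fin (suc k) → Fin k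
    m = merge 𝔊 (tail 𝔊 Φ e) (head 𝔊 Φ e) e-link

    f-becomes-loop : Parallel 𝔊 Φ e f → m (tail 𝔊 Φ f) ≡ m (head 𝔊 Φ f)
    f-becomes-loop (inj₁ (t≡t , h≡h)) =
      ≡.trans (cong m (≡.sym t≡t)) (≡.trans (merge-identifies _ _ e-link) (cong m h≡h))
    f-becomes-loop (inj₂ (t≡h , h≡t)) =
      ≡.trans (cong m (≡.sym h≡t)) (≡.trans (≡.sym (merge-identifies _ _ e-link)) (cong m t≡h))

  duplicate-neutralDigon : ∀ {V} (x : Edge 𝔊 V) (xs : List (Edge 𝔊 V)) (x∈xs : x ∈ xs) →
    proj₁ x ≢ proj₁ (proj₂ x) → proj₂ (proj₂ x) ≈ ε →
    NeutralDigon 𝔊 (gg V (x ∷ xs)) zero (suc (index x∈xs))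
  duplicate-neutralDigon x xs x∈xs link neutral rewrite ≡.sym (lookup-index x∈xs) =
    (λ ()) , link , link , inj₁ (refl , refl) , neutral , neutral

  -- the new vertex is zero; old vertices are shifted by suc, so that contracting
  -- a link to zero undoes the shift definitionally
  detach : ∀ {n} → Edge 𝔊 n → Edge 𝔊 (suc n)
  detach (a , _ , g) = suc a , zero , g

  detachAt : ∀ {n} (es : List (Edge 𝔊 n)) → Fin (length es) → List (Edge 𝔊 (suc n))
  detachAt (x ∷ es) zero    = detach x ∷ map (mapEdge 𝔊 suc) es
  detachAt (x ∷ es) (suc i) = mapEdge 𝔊 suc x ∷ detachAt es i

  detach∈detachAt : ∀ {n} (es : List (Edge 𝔊 n)) i → detach (lookup es i) ∈ detachAt es i
  detach∈detachAt (x ∷ es) zero    = here refl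
  detach∈detachAt (x ∷ es) (suc i) = there (detach∈detachAt es i)

  merge-detachAt : ∀ {n} {t : Fin n} (t≢0 : suc t ≢ zero) (es : List (Edge 𝔊 n)) i →
    proj₁ (proj₂ (lookup es i)) ≡ t →
    map (mapEdge 𝔊 (merge 𝔊 (suc t) zero t≢0)) (detachAt es i) ≡ es
  merge-detachAt t≢0 (x ∷ es) zero h≡t =
    cong₂ _∷_ (cong (λ b → proj₁ x , b , proj₂ (proj₂ x)) (≡.sym h≡t))
              (≡.trans (≡.sym (map-∘ es)) (map-id es))
  merge-detachAt t≢0 (x ∷ es) (suc i) h≡t = cong (x ∷_) (merge-detachAt t≢0 es i h≡t)

  splitLoop : (Φ : GainGraph 𝔊) → EdgeIx 𝔊 Φ → GainGraph 𝔊
  splitLoop Φ l = gg (suc (V Φ)) (detach (lookup (edges Φ) l) ∷ detachAt (edges Φ) l)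

  splitLoop-neutralDigon : (Φ : GainGraph 𝔊) (l : EdgeIx 𝔊 Φ) → IsNeutral 𝔊 Φ l →
    Σ (EdgeIx 𝔊 (splitLoop Φ l)) (NeutralDigon 𝔊 (splitLoop Φ l) zero)
  splitLoop-neutralDigon Φ l neutral =
    _ , duplicate-neutralDigon _ _ (detach∈detachAt (edges Φ) l) (λ ()) neutral

  contract-splitLoop : (Φ : GainGraph 𝔊) (l : EdgeIx 𝔊 Φ) (link : IsLink 𝔊 (splitLoop Φ l) zero) →
    IsLoop 𝔊 Φ l → contract 𝔊 (splitLoop Φ l) zero link ≡ Φ
  contract-splitLoop Φ l link loop = cong (gg (V Φ)) (merge-detachAt link (edges Φ) l (≡.sym loop))

lemma4p1 : {c ℓ a r : Level} (𝔊 : Group c ℓ) (A : AbelianGroup a r)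
    (F : GainGraph 𝔊 → AbelianGroup.Carrier A) →
    DeletionContraction 𝔊 A F →
    (NeutralLoopNullity 𝔊 A F ⇔ InvariantUnderNeutralEdgeSimplification 𝔊 A F)
lemma4p1 𝔊 A F deletion-contraction = mk⇔ nullity⇒invariance invariance⇒nullity
  where
  open AbelianGroup A using (_≈_; _∙_; _⁻¹; group; trans; sym; reflexive; ∙-congˡ; ⁻¹-cong)

  nullity⇒invariance : NeutralLoopNullity 𝔊 A F → InvariantUnderNeutralEdgeSimplification 𝔊 A F
  nullity⇒invariance nullity Φ e f digon@(_ , e-link , _ , _ , e-neutral , _) =
    trans (deletion-contraction Φ e e-link e-neutral)
          (z≈ε⇒y∙z⁻¹≈y group (nullity _ (contract-neutralDigon 𝔊 Φ e f digon)))

  invariance⇒nullity : InvariantUnderNeutralEdgeSimplification 𝔊 A F → NeutralLoopNullity 𝔊 A F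
  invariance⇒nullity invariance Φ (l , loop , neutral)
    with splitLoop-neutralDigon 𝔊 Φ l neutral
  ... | f , digon@(_ , link , _) = y∙z⁻¹≈y⇒z≈ε group (trans (sym split) (invariance Ψ zero f digon))
    where
    Ψ : GainGraph 𝔊
    Ψ = splitLoop 𝔊 Φ l

    split : F Ψ ≈ F (delete 𝔊 Ψ zero) ∙ F Φ ⁻¹
    split = trans (deletion-contraction Ψ zero link neutral)
                  (∙-congˡ (⁻¹-cong (reflexive (cong F (contract-splitLoop 𝔊 Φ l link loop)))))
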